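{- For every integer $r\ge 0$, every positive integer $m$ and every positive integer $n$, \[ \frac{1}{2m+1}\sum_{j=1}^{m+1}\binom{2m+1}{2j-1}\left(\Sigma^r n^{2j-1}\right)B_{2m+2-2j}=\Sigma^{r+1}n^{2m}-\frac12\,\Sigma^r n^{2m}, \] and \[ \frac{1}{2m}\sum_{j=1}^{m}\binom{2m}{2j}\left(\Sigma^r n^{2j}\right)B_{2m-2j}=\Sigma^{r+1}n^{2m-1}-\frac12\,\Sigma^r n^{2m-1}. \]
   Context: For integers $m\ge 0$ the $r$-fold power sums are defined by $\Sigma^0 n^m=n^m$ and $\Sigma^{r+1}n^m=\Sigma^r 1^m+\Sigma^r 2^m+\cdots+\Sigma^r n^m$ (so $\Sigma^1 n^m=1^m+2^m+\cdots+n^m$). The Bernoulli numbers are $B_0=1$ and $B_k=-\frac{1}{k+1}\sum_{j=0}^{k-1}\binom{k+1}{j}B_j$ for $k\ge1$ (so $B_1=-1/2$). -}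

module Defs where

open import Data.Nat using (ℕ; zero; suc; _+_; _*_; _∸_; _^_; _≤?_)
open import Data.Nat.Combinatorics using (_C_)
open import Data.Integer using (+_)
open import Data.Rational using (ℚ; _/_; 0ℚ; 1ℚ; -_) renaming (_+_ to _+ℚ_; _*_ to _*ℚ_)
open import Data.Bool using (if_then_else_)
open import Relation.Nullary.Decidable using (does)

ℕ→ℚ : ℕ → ℚ
ℕ→ℚ n = + n / 1

sumℕ< : ℕ → (ℕ → ℕ) → ℕ
sumℕ< zero    f = 0
sumℕ< (suc N) f = sumℕ< N f + f N

sumℚ< : ℕ → (ℕ → ℚ) → ℚ
sumℚ< zero    f = 0ℚ
sumℚ< (suc N) f = sumℚ< N f +ℚ f N

sumℚ1to : ℕ → (ℕ → ℚ) → ℚ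
sumℚ1to N f = sumℚ< N (λ i → f (suc i))

-- r-fold power sums: Σ^0 n^m = n^m,  Σ^{r+1} n^m = Σ_{k=1}^{n} Σ^r k^m
powSum : (r n m : ℕ) → ℕ
powSum zero    n m = n ^ m
powSum (suc r) n m = sumℕ< n (λ i → powSum r (suc i) m)

-- Bernoulli numbers (B_1 = -1/2) via
--   B_0 = 1,  B_k = -1/(k+1) Σ_{j=0}^{k-1} binom(k+1, j) B_j.
-- bernoulliTable k j = B_j for all j ≤ k (course-of-values recursion).
bernoulliTable : ℕ → ℕ → ℚ
bernoulliTable zero    j = 1ℚ
bernoulliTable (suc k) j =
  if does (j ≤? k)
  then bernoulliTable k j
  else - ((+ 1 / suc (suc k)) *ℚ
          sumℚ< (suc k) (λ i → ℕ→ℚ (suc (suc k) C i) *ℚ bernoulliTable k i))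

bernoulli : ℕ → ℚ
bernoulli k = bernoulliTable k k

{-# OPTIONS --safe #-}
module Submission where

-- Write B_q(x) = Σ_e C(q,e) B_{q-e} x^e for the Bernoulli polynomial. The defining recursion
-- of the B_k says Σ_t C(N,t) B_{N-t} = B_N + [N = 1], and with the binomial theorem this gives
-- B_q(x + 1) − B_q(x) = q x^{q-1}. Telescoping, B_q(n) = B_q + q Σ_{k<n} k^{q-1} and
-- B_q(−n) = B_q − q Σ_{k=1}^{n} (−k)^{q-1}. Half the difference (q odd) or half the sum (q even)
-- of these keeps exactly the powers x^e with e ≡ q (mod 2), which is the case r = 0 of both
-- identities. Both sides are linear in the power sums and Σ^{r+1} is obtained from Σ^r by
-- summing over 1..n, so induction on r gives the general case.

open import Defs
open import Data.Nat using (ℕ; zero; suc; _+_; _*_; _∸_; _^_; _<_; _≤_; _!; _≤ᵇ_; _<ᵇ_)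
open import Data.Nat.Base using (>-nonZero)
open import Data.Nat.Properties using (m*n≢0)
import Data.Nat.Properties as ℕₚ
open import Data.Nat.Tactic.RingSolver using (solve-∀)
open import Data.Nat.Combinatorics
  using (_C_; nCk≡n!/k![n-k]!; k![n∸k]!∣n!; nCk+nC[k+1]≡[n+1]C[k+1]; k>n⇒nCk≡0; nCk≡nC[n∸k]; nCn≡1; nC1≡n)
open import Data.Nat.DivMod using (m/n*n≡m)
open import Data.Integer as ℤ using (+_)
import Data.Integer.Properties as ℤₚ
open import Data.Rational using (ℚ; _/_; ½; 0ℚ; 1ℚ; toℚᵘ)
  renaming (_+_ to _+ℚ_; _*_ to _*ℚ_; _-_ to _-ℚ_; -_ to -ℚ_)
open import Data.Rational.Base using (+-*-rawSemiring)
import Data.Rational.Properties as ℚₚ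
open import Data.Rational.Unnormalised as ℚᵘ using (mkℚᵘ; *≡*)
import Data.Rational.Unnormalised.Properties as ℚᵘₚ
open import Data.Rational.Solver using (module +-*-Solver)
open +-*-Solver
open import Algebra.Definitions.RawSemiring +-*-rawSemiring using () renaming (_^_ to _^ℚ_)
open import Data.Bool using (true; false; T)
open import Data.Unit using (tt)
open import Data.Product using (_×_; _,_)
open import Relation.Binary.PropositionalEquality

ℕ→ℚ≃mkℚᵘ : ∀ a → toℚᵘ (ℕ→ℚ a) ℚᵘ.≃ mkℚᵘ (+ a) 0
ℕ→ℚ≃mkℚᵘ a = ℚₚ.toℚᵘ-fromℚᵘ (mkℚᵘ (+ a) 0)

ℕ→ℚ-+ : ∀ a b → ℕ→ℚ (a + b) ≡ ℕ→ℚ a +ℚ ℕ→ℚ b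
ℕ→ℚ-+ a b = ℚₚ.toℚᵘ-injective (begin
    toℚᵘ (ℕ→ℚ (a + b))                  ≈⟨ ℕ→ℚ≃mkℚᵘ (a + b) ⟩
    mkℚᵘ (+ (a + b)) 0                   ≈⟨ *≡* integral ⟩
    mkℚᵘ (+ a) 0 ℚᵘ.+ mkℚᵘ (+ b) 0       ≈⟨ ℚᵘₚ.+-cong (ℕ→ℚ≃mkℚᵘ a) (ℕ→ℚ≃mkℚᵘ b) ⟨
    toℚᵘ (ℕ→ℚ a) ℚᵘ.+ toℚᵘ (ℕ→ℚ b)       ≈⟨ ℚₚ.toℚᵘ-homo-+ (ℕ→ℚ a) (ℕ→ℚ b) ⟨
    toℚᵘ (ℕ→ℚ a +ℚ ℕ→ℚ b)                ∎)
  where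
  open ℚᵘₚ.≃-Reasoning
  integral : + (a + b) ℤ.* + 1 ≡ (+ a ℤ.* + 1 ℤ.+ + b ℤ.* + 1) ℤ.* + 1
  integral = trans (ℤₚ.*-identityʳ _) (trans (ℤₚ.pos-+ a b) (sym (trans (ℤₚ.*-identityʳ _)
    (cong₂ ℤ._+_ (ℤₚ.*-identityʳ (+ a)) (ℤₚ.*-identityʳ (+ b))))))

ℕ→ℚ-* : ∀ a b → ℕ→ℚ (a * b) ≡ ℕ→ℚ a *ℚ ℕ→ℚ b
ℕ→ℚ-* a b = ℚₚ.toℚᵘ-injective (begin
    toℚᵘ (ℕ→ℚ (a * b))                  ≈⟨ ℕ→ℚ≃mkℚᵘ (a * b) ⟩
    mkℚᵘ (+ (a * b)) 0                   ≈⟨ *≡* integral ⟩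
    mkℚᵘ (+ a) 0 ℚᵘ.* mkℚᵘ (+ b) 0       ≈⟨ ℚᵘₚ.*-cong (ℕ→ℚ≃mkℚᵘ a) (ℕ→ℚ≃mkℚᵘ b) ⟨
    toℚᵘ (ℕ→ℚ a) ℚᵘ.* toℚᵘ (ℕ→ℚ b)       ≈⟨ ℚₚ.toℚᵘ-homo-* (ℕ→ℚ a) (ℕ→ℚ b) ⟨
    toℚᵘ (ℕ→ℚ a *ℚ ℕ→ℚ b)                ∎)
  where
  open ℚᵘₚ.≃-Reasoning
  integral : + (a * b) ℤ.* + 1 ≡ (+ a ℤ.* + b) ℤ.* + 1
  integral = cong (ℤ._* + 1) (ℤₚ.pos-* a b)

ℕ→ℚ-suc : ∀ n → ℕ→ℚ (suc n) ≡ ℕ→ℚ n +ℚ 1ℚ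
ℕ→ℚ-suc n = trans (cong ℕ→ℚ (ℕₚ.+-comm 1 n)) (ℕ→ℚ-+ n 1)

ℕ→ℚ-^ : ∀ n e → ℕ→ℚ (n ^ e) ≡ ℕ→ℚ n ^ℚ e
ℕ→ℚ-^ n zero    = refl
ℕ→ℚ-^ n (suc e) = trans (ℕ→ℚ-* n (n ^ e)) (cong (ℕ→ℚ n *ℚ_) (ℕ→ℚ-^ n e))

ℕ→ℚ-sumℕ< : ∀ N f → ℕ→ℚ (sumℕ< N f) ≡ sumℚ< N (λ i → ℕ→ℚ (f i))
ℕ→ℚ-sumℕ< zero    f = refl
ℕ→ℚ-sumℕ< (suc N) f = trans (ℕ→ℚ-+ (sumℕ< N f) (f N)) (cong (_+ℚ ℕ→ℚ (f N)) (ℕ→ℚ-sumℕ< N f))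

1/[1+n]*[1+n]≡1 : ∀ n → (+ 1 / suc n) *ℚ ℕ→ℚ (suc n) ≡ 1ℚ
1/[1+n]*[1+n]≡1 n = ℚₚ.toℚᵘ-injective (begin
    toℚᵘ ((+ 1 / suc n) *ℚ ℕ→ℚ (suc n))
  ≈⟨ ℚₚ.toℚᵘ-homo-* (+ 1 / suc n) (ℕ→ℚ (suc n)) ⟩
    toℚᵘ (+ 1 / suc n) ℚᵘ.* toℚᵘ (ℕ→ℚ (suc n))
  ≈⟨ ℚᵘₚ.*-cong (ℚₚ.toℚᵘ-fromℚᵘ (mkℚᵘ (+ 1) n)) (ℕ→ℚ≃mkℚᵘ (suc n)) ⟩
    mkℚᵘ (+ 1) n ℚᵘ.* mkℚᵘ (+ suc n) 0
  ≈⟨ *≡* integral ⟩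
    mkℚᵘ (+ 1) 0
  ∎)
  where
  open ℚᵘₚ.≃-Reasoning
  integral : (+ 1 ℤ.* + suc n) ℤ.* + 1 ≡ + 1 ℤ.* + (suc n * 1)
  integral = trans (ℤₚ.*-identityʳ _) (cong (+ 1 ℤ.*_) (cong +_ (sym (ℕₚ.*-identityʳ (suc n)))))

1/[1+n]*[[1+n]*x]≡x : ∀ n x → (+ 1 / suc n) *ℚ (ℕ→ℚ (suc n) *ℚ x) ≡ x
1/[1+n]*[[1+n]*x]≡x n x = trans (sym (ℚₚ.*-assoc (+ 1 / suc n) (ℕ→ℚ (suc n)) x))
  (trans (cong (_*ℚ x) (1/[1+n]*[1+n]≡1 n)) (ℚₚ.*-identityˡ x))

sumℚ<-cong< : ∀ N {f g : ℕ → ℚ} → (∀ i → i < N → f i ≡ g i) → sumℚ< N f ≡ sumℚ< N g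
sumℚ<-cong< zero    f≡g = refl
sumℚ<-cong< (suc N) f≡g =
  cong₂ _+ℚ_ (sumℚ<-cong< N (λ i i<N → f≡g i (ℕₚ.m<n⇒m<1+n i<N))) (f≡g N ℕₚ.≤-refl)

sumℚ<-cong : ∀ N {f g : ℕ → ℚ} → (∀ i → f i ≡ g i) → sumℚ< N f ≡ sumℚ< N g
sumℚ<-cong N f≡g = sumℚ<-cong< N (λ i _ → f≡g i)

sumℚ<-0 : ∀ N → sumℚ< N (λ _ → 0ℚ) ≡ 0ℚ
sumℚ<-0 zero    = refl
sumℚ<-0 (suc N) = trans (ℚₚ.+-identityʳ _) (sumℚ<-0 N)

sumℚ<-+ : ∀ N f g → sumℚ< N (λ i → f i +ℚ g i) ≡ sumℚ< N f +ℚ sumℚ< N g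
sumℚ<-+ zero    f g = refl
sumℚ<-+ (suc N) f g = trans (cong (_+ℚ (f N +ℚ g N)) (sumℚ<-+ N f g))
  (solve 4 (λ a b c d → (a :+ b) :+ (c :+ d) := (a :+ c) :+ (b :+ d)) refl
    (sumℚ< N f) (sumℚ< N g) (f N) (g N))

*-distribˡ-sumℚ< : ∀ N c f → c *ℚ sumℚ< N f ≡ sumℚ< N (λ i → c *ℚ f i)
*-distribˡ-sumℚ< zero    c f = ℚₚ.*-zeroʳ c
*-distribˡ-sumℚ< (suc N) c f = trans (ℚₚ.*-distribˡ-+ c (sumℚ< N f) (f N))
  (cong (_+ℚ (c *ℚ f N)) (*-distribˡ-sumℚ< N c f))

*-distribʳ-sumℚ< : ∀ N c f → sumℚ< N f *ℚ c ≡ sumℚ< N (λ i → f i *ℚ c)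
*-distribʳ-sumℚ< N c f = trans (ℚₚ.*-comm _ c)
  (trans (*-distribˡ-sumℚ< N c f) (sumℚ<-cong N (λ i → ℚₚ.*-comm c (f i))))

neg-distrib-sumℚ< : ∀ N f → -ℚ sumℚ< N f ≡ sumℚ< N (λ i → -ℚ f i)
neg-distrib-sumℚ< zero    f = refl
neg-distrib-sumℚ< (suc N) f = trans (ℚₚ.neg-distrib-+ (sumℚ< N f) (f N))
  (cong (_+ℚ (-ℚ f N)) (neg-distrib-sumℚ< N f))

sumℚ<-- : ∀ N f g → sumℚ< N (λ i → f i -ℚ g i) ≡ sumℚ< N f -ℚ sumℚ< N g
sumℚ<-- N f g = trans (sumℚ<-+ N f (λ i → -ℚ g i)) (cong (sumℚ< N f +ℚ_) (sym (neg-distrib-sumℚ< N g)))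

sumℚ<-head : ∀ N f → sumℚ< (suc N) f ≡ f 0 +ℚ sumℚ< N (λ i → f (suc i))
sumℚ<-head zero    f = trans (ℚₚ.+-identityˡ (f 0)) (sym (ℚₚ.+-identityʳ (f 0)))
sumℚ<-head (suc N) f = trans (cong (_+ℚ f (suc N)) (sumℚ<-head N f)) (ℚₚ.+-assoc (f 0) _ (f (suc N)))

sumℚ<-swap : ∀ N M (x : ℕ → ℕ → ℚ) →
  sumℚ< N (λ j → sumℚ< M (λ i → x i j)) ≡ sumℚ< M (λ i → sumℚ< N (λ j → x i j))
sumℚ<-swap zero    M x = sym (sumℚ<-0 M)
sumℚ<-swap (suc N) M x = trans (cong (_+ℚ sumℚ< M (λ i → x i N)) (sumℚ<-swap N M x))
  (sym (sumℚ<-+ M (λ i → sumℚ< N (λ j → x i j)) (λ i → x i N)))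

sumℚ<-triangle : ∀ N (f : ℕ → ℕ → ℚ) →
  sumℚ< N (λ e → sumℚ< (suc e) (f e)) ≡ sumℚ< N (λ l → sumℚ< (N ∸ l) (λ t → f (l + t) l))
sumℚ<-triangle zero    f = refl
sumℚ<-triangle (suc N) f = begin
    sumℚ< N (λ e → sumℚ< (suc e) (f e)) +ℚ (sumℚ< N (f N) +ℚ f N N)
  ≡⟨ cong (_+ℚ (sumℚ< N (f N) +ℚ f N N)) (sumℚ<-triangle N f) ⟩
    Tri +ℚ (sumℚ< N (f N) +ℚ f N N)
  ≡⟨ ℚₚ.+-assoc Tri (sumℚ< N (f N)) (f N N) ⟨
    (Tri +ℚ sumℚ< N (f N)) +ℚ f N N
  ≡⟨ cong₂ _+ℚ_ (sumℚ<-+ N _ (f N)) diagonal ⟨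
    sumℚ< N (λ l → sumℚ< (N ∸ l) (λ t → f (l + t) l) +ℚ f N l) +ℚ sumℚ< (suc N ∸ N) (λ t → f (N + t) N)
  ≡⟨ cong (_+ℚ sumℚ< (suc N ∸ N) (λ t → f (N + t) N)) (sumℚ<-cong< N row) ⟨
    sumℚ< N (λ l → sumℚ< (suc N ∸ l) (λ t → f (l + t) l)) +ℚ sumℚ< (suc N ∸ N) (λ t → f (N + t) N)
  ∎
  where
  open ≡-Reasoning
  Tri = sumℚ< N (λ l → sumℚ< (N ∸ l) (λ t → f (l + t) l))
  diagonal : sumℚ< (suc N ∸ N) (λ t → f (N + t) N) ≡ f N N
  diagonal rewrite ℕₚ.m+n∸n≡m 1 N | ℕₚ.+-identityʳ N = ℚₚ.+-identityˡ (f N N)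
  row : ∀ l → l < N → sumℚ< (suc N ∸ l) (λ t → f (l + t) l) ≡ sumℚ< (N ∸ l) (λ t → f (l + t) l) +ℚ f N l
  row l l<N rewrite ℕₚ.+-∸-assoc 1 (ℕₚ.<⇒≤ l<N) | ℕₚ.m+[n∸m]≡n (ℕₚ.<⇒≤ l<N) = refl

sumℚ<-even-odd : ∀ M f → sumℚ< (M + M) f ≡ sumℚ< M (λ j → f (j + j) +ℚ f (suc (j + j)))
sumℚ<-even-odd zero    f = refl
sumℚ<-even-odd (suc M) f rewrite ℕₚ.+-suc M M = trans
  (ℚₚ.+-assoc (sumℚ< (M + M) f) (f (M + M)) (f (suc (M + M))))
  (cong (_+ℚ (f (M + M) +ℚ f (suc (M + M)))) (sumℚ<-even-odd M f))

sumℚ<-reverse : ∀ N f → sumℚ< N f ≡ sumℚ< N (λ i → f (N ∸ suc i))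
sumℚ<-reverse zero    f = refl
sumℚ<-reverse (suc N) f = begin
    sumℚ< N f +ℚ f N                                ≡⟨ cong (_+ℚ f N) (sumℚ<-reverse N f) ⟩
    sumℚ< N (λ i → f (N ∸ suc i)) +ℚ f N             ≡⟨ ℚₚ.+-comm _ (f N) ⟩
    f N +ℚ sumℚ< N (λ i → f (N ∸ suc i))             ≡⟨ sumℚ<-head N (λ i → f (N ∸ i)) ⟨
    sumℚ< (suc N) (λ i → f (suc N ∸ suc i))          ∎
  where open ≡-Reasoning

neg-^-even : ∀ x e → (-ℚ x) ^ℚ (e + e) ≡ x ^ℚ (e + e)
neg-^-even x zero    = refl
neg-^-even x (suc e) rewrite ℕₚ.+-suc e e =
  trans (cong (λ y → -ℚ x *ℚ (-ℚ x *ℚ y)) (neg-^-even x e))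
    (solve 2 (λ x y → :- x :* (:- x :* y) := x :* (x :* y)) refl x (x ^ℚ (e + e)))

neg-^-odd : ∀ x e → (-ℚ x) ^ℚ suc (e + e) ≡ -ℚ (x ^ℚ suc (e + e))
neg-^-odd x e = trans (cong (-ℚ x *ℚ_) (neg-^-even x e)) (sym (ℚₚ.neg-distribˡ-* x (x ^ℚ (e + e))))

binomial-+1 : ∀ e x → (x +ℚ 1ℚ) ^ℚ e ≡ sumℚ< (suc e) (λ l → ℕ→ℚ (e C l) *ℚ x ^ℚ l)
binomial-+1 zero    x = refl
binomial-+1 (suc e) x = sym (begin
    sumℚ< (suc (suc e)) (λ l → ℕ→ℚ (suc e C l) *ℚ x ^ℚ l)
  ≡⟨ sumℚ<-head (suc e) _ ⟩
    1ℚ *ℚ 1ℚ +ℚ sumℚ< (suc e) (λ l → ℕ→ℚ (suc e C suc l) *ℚ x ^ℚ suc l)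
  ≡⟨ cong (1ℚ *ℚ 1ℚ +ℚ_) (trans (sumℚ<-cong (suc e) pascal) (sumℚ<-+ (suc e) _ _)) ⟩
    1ℚ *ℚ 1ℚ +ℚ (sumℚ< (suc e) (λ l → ℕ→ℚ (e C l) *ℚ x ^ℚ suc l) +ℚ Shifted)
  ≡⟨ cong₂ (λ a b → 1ℚ *ℚ 1ℚ +ℚ (a +ℚ b)) timesX dropHead ⟨
    1ℚ *ℚ 1ℚ +ℚ (x *ℚ P +ℚ (P -ℚ 1ℚ))
  ≡⟨ solve 2 (λ x P → con 1ℚ :* con 1ℚ :+ (x :* P :+ (P :- con 1ℚ)) := (x :+ con 1ℚ) :* P) refl x P ⟩
    (x +ℚ 1ℚ) *ℚ P
  ≡⟨ cong ((x +ℚ 1ℚ) *ℚ_) (binomial-+1 e x) ⟨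
    (x +ℚ 1ℚ) *ℚ (x +ℚ 1ℚ) ^ℚ e
  ∎)
  where
  open ≡-Reasoning
  P = sumℚ< (suc e) (λ l → ℕ→ℚ (e C l) *ℚ x ^ℚ l)
  Shifted = sumℚ< (suc e) (λ l → ℕ→ℚ (e C suc l) *ℚ x ^ℚ suc l)
  pascal : ∀ l → ℕ→ℚ (suc e C suc l) *ℚ x ^ℚ suc l
               ≡ ℕ→ℚ (e C l) *ℚ x ^ℚ suc l +ℚ ℕ→ℚ (e C suc l) *ℚ x ^ℚ suc l
  pascal l = trans (cong (λ c → ℕ→ℚ c *ℚ x ^ℚ suc l) (sym (nCk+nC[k+1]≡[n+1]C[k+1] e l)))
    (trans (cong (_*ℚ x ^ℚ suc l) (ℕ→ℚ-+ (e C l) (e C suc l)))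
      (ℚₚ.*-distribʳ-+ (x ^ℚ suc l) (ℕ→ℚ (e C l)) (ℕ→ℚ (e C suc l))))
  timesX : x *ℚ P ≡ sumℚ< (suc e) (λ l → ℕ→ℚ (e C l) *ℚ x ^ℚ suc l)
  timesX = trans (*-distribˡ-sumℚ< (suc e) x _) (sumℚ<-cong (suc e) (λ l →
    solve 3 (λ x c p → x :* (c :* p) := c :* (x :* p)) refl x (ℕ→ℚ (e C l)) (x ^ℚ l)))
  topVanishes : ℕ→ℚ (e C suc e) *ℚ x ^ℚ suc e ≡ 0ℚ
  topVanishes rewrite k>n⇒nCk≡0 (ℕₚ.n<1+n e) = ℚₚ.*-zeroˡ (x ^ℚ suc e)
  dropHead : P -ℚ 1ℚ ≡ Shifted
  dropHead = begin
      P -ℚ 1ℚ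
    ≡⟨ trans (cong (λ z → (P +ℚ z) -ℚ 1ℚ) topVanishes) (cong (_-ℚ 1ℚ) (ℚₚ.+-identityʳ P)) ⟨
      (P +ℚ ℕ→ℚ (e C suc e) *ℚ x ^ℚ suc e) -ℚ 1ℚ
    ≡⟨ cong (_-ℚ 1ℚ) (sumℚ<-head (suc e) _) ⟩
      (1ℚ *ℚ 1ℚ +ℚ Shifted) -ℚ 1ℚ
    ≡⟨ solve 1 (λ t → (con 1ℚ :* con 1ℚ :+ t) :- con 1ℚ := t) refl Shifted ⟩
      Shifted
    ∎

nCk*[k!*[n∸k]!]≡n! : ∀ {n k} → k ≤ n → (n C k) * (k ! * (n ∸ k) !) ≡ n !
nCk*[k!*[n∸k]!]≡n! {n} {k} k≤n = trans (cong (_* (k ! * (n ∸ k) !)) (nCk≡n!/k![n-k]! k≤n))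
  (m/n*n≡m {{k !* (n ∸ k) !≢0}} (k![n∸k]!∣n! k≤n))
  where open ℕₚ using (_!*_!≢0)

nC[l+t]*[l+t]Cl≡nCl*[n∸l]Ct : ∀ n l t → l + t ≤ n → (n C (l + t)) * ((l + t) C l) ≡ (n C l) * ((n ∸ l) C t)
nC[l+t]*[l+t]Cl≡nCl*[n∸l]Ct n l t l+t≤n =
  ℕₚ.*-cancelʳ-≡ _ _ D {{m*n≢0 (l !) (t ! * (n ∸ (l + t)) !) {{l !≢0}} {{t !* (n ∸ (l + t)) !≢0}}}}
    (trans viaLeft (sym viaRight))
  where
  open ℕₚ using (_!≢0; _!*_!≢0)
  open ≡-Reasoning
  D = l ! * (t ! * (n ∸ (l + t)) !)
  reassocˡ : ∀ A B x y z → A * B * (x * (y * z)) ≡ A * ((B * (x * y)) * z)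
  reassocˡ = solve-∀
  reassocʳ : ∀ A B x y z → A * B * (x * (y * z)) ≡ A * (x * (B * (y * z)))
  reassocʳ = solve-∀
  viaLeft : (n C (l + t)) * ((l + t) C l) * D ≡ n !
  viaLeft = begin
      (n C (l + t)) * ((l + t) C l) * D
    ≡⟨ reassocˡ (n C (l + t)) ((l + t) C l) (l !) (t !) ((n ∸ (l + t)) !) ⟩
      (n C (l + t)) * (((l + t) C l) * (l ! * t !) * (n ∸ (l + t)) !)
    ≡⟨ cong (λ s → (n C (l + t)) * (((l + t) C l) * (l ! * s !) * (n ∸ (l + t)) !)) (ℕₚ.m+n∸m≡n l t) ⟨
      (n C (l + t)) * (((l + t) C l) * (l ! * ((l + t) ∸ l) !) * (n ∸ (l + t)) !)
    ≡⟨ cong (λ s → (n C (l + t)) * (s * (n ∸ (l + t)) !)) (nCk*[k!*[n∸k]!]≡n! (ℕₚ.m≤m+n l t)) ⟩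
      (n C (l + t)) * ((l + t) ! * (n ∸ (l + t)) !)
    ≡⟨ nCk*[k!*[n∸k]!]≡n! l+t≤n ⟩
      n !
    ∎
  viaRight : (n C l) * ((n ∸ l) C t) * D ≡ n !
  viaRight = begin
      (n C l) * ((n ∸ l) C t) * D
    ≡⟨ cong (λ s → (n C l) * ((n ∸ l) C t) * (l ! * (t ! * s !))) (ℕₚ.∸-+-assoc n l t) ⟨
      (n C l) * ((n ∸ l) C t) * (l ! * (t ! * (n ∸ l ∸ t) !))
    ≡⟨ reassocʳ (n C l) ((n ∸ l) C t) (l !) (t !) ((n ∸ l ∸ t) !) ⟩
      (n C l) * (l ! * (((n ∸ l) C t) * (t ! * (n ∸ l ∸ t) !)))
    ≡⟨ cong (λ s → (n C l) * (l ! * s)) (nCk*[k!*[n∸k]!]≡n! t≤n∸l) ⟩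
      (n C l) * (l ! * (n ∸ l) !)
    ≡⟨ nCk*[k!*[n∸k]!]≡n! (ℕₚ.≤-trans (ℕₚ.m≤m+n l t) l+t≤n) ⟩
      n !
    ∎
    where
    t≤n∸l : t ≤ n ∸ l
    t≤n∸l = ℕₚ.≤-trans (ℕₚ.≤-reflexive (sym (ℕₚ.m+n∸m≡n l t))) (ℕₚ.∸-monoˡ-≤ l l+t≤n)

δ₁ : ℕ → ℚ
δ₁ 1 = 1ℚ
δ₁ _ = 0ℚ

n<ᵇn≡false : ∀ n → (n <ᵇ n) ≡ false
n<ᵇn≡false zero    = refl
n<ᵇn≡false (suc n) = n<ᵇn≡false n

bernoulli-suc : ∀ k → bernoulli (suc k) ≡
  -ℚ ((+ 1 / suc (suc k)) *ℚ sumℚ< (suc k) (λ i → ℕ→ℚ (suc (suc k) C i) *ℚ bernoulliTable k i))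
bernoulli-suc k rewrite n<ᵇn≡false k = refl

bernoulliTable-≤ : ∀ {k j} → j ≤ k → bernoulliTable k j ≡ bernoulli j
bernoulliTable-≤ {zero} {zero} _ = refl
bernoulliTable-≤ {suc k} {j} j≤1+k with j ≤ᵇ k in eq
... | true  = bernoulliTable-≤ (ℕₚ.≤ᵇ⇒≤ j k (subst T (sym eq) tt))
... | false = trans (sym (bernoulli-suc k)) (cong bernoulli (sym j≡1+k))
  where
  j≡1+k : j ≡ suc k
  j≡1+k = ℕₚ.≤-antisym j≤1+k (ℕₚ.≰⇒> (λ j≤k → subst T eq (ℕₚ.≤⇒≤ᵇ j≤k)))

sum-C*bernoulli : ∀ N → sumℚ< N (λ i → ℕ→ℚ (N C i) *ℚ bernoulli i) ≡ δ₁ N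
sum-C*bernoulli zero          = refl
sum-C*bernoulli (suc zero)    = refl
sum-C*bernoulli (suc (suc k)) = begin
    sumℚ< (suc k) (λ i → ℕ→ℚ (N C i) *ℚ bernoulli i) +ℚ ℕ→ℚ (N C suc k) *ℚ bernoulli (suc k)
  ≡⟨ cong₂ (λ a c → a +ℚ ℕ→ℚ c *ℚ bernoulli (suc k)) (sumℚ<-cong< (suc k) fromTable) NC[N∸1]≡N ⟩
    Sk +ℚ ℕ→ℚ N *ℚ bernoulli (suc k)
  ≡⟨ cong (λ b → Sk +ℚ ℕ→ℚ N *ℚ b) (bernoulli-suc k) ⟩
    Sk +ℚ ℕ→ℚ N *ℚ (-ℚ ((+ 1 / N) *ℚ Sk))
  ≡⟨ solve 3 (λ s n h → s :+ n :* (:- (h :* s)) := s :- (h :* n) :* s) refl Sk (ℕ→ℚ N) (+ 1 / N) ⟩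
    Sk -ℚ ((+ 1 / N) *ℚ ℕ→ℚ N) *ℚ Sk
  ≡⟨ cong (λ c → Sk -ℚ c *ℚ Sk) (1/[1+n]*[1+n]≡1 (suc k)) ⟩
    Sk -ℚ 1ℚ *ℚ Sk
  ≡⟨ solve 1 (λ s → s :- con 1ℚ :* s := con 0ℚ) refl Sk ⟩
    0ℚ
  ∎
  where
  open ≡-Reasoning
  N = suc (suc k)
  Sk = sumℚ< (suc k) (λ i → ℕ→ℚ (N C i) *ℚ bernoulliTable k i)
  fromTable : ∀ i → i < suc k → ℕ→ℚ (N C i) *ℚ bernoulli i ≡ ℕ→ℚ (N C i) *ℚ bernoulliTable k i
  fromTable i i<1+k = cong (ℕ→ℚ (N C i) *ℚ_) (sym (bernoulliTable-≤ (ℕₚ.≤-pred i<1+k)))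
  NC[N∸1]≡N : N C suc k ≡ N
  NC[N∸1]≡N = trans (nCk≡nC[n∸k] (ℕₚ.n≤1+n (suc k))) (trans (cong (N C_) (ℕₚ.m+n∸n≡m 1 (suc k))) (nC1≡n N))

sum-C*bernoulli-reversed : ∀ N → sumℚ< (suc N) (λ t → ℕ→ℚ (N C t) *ℚ bernoulli (N ∸ t)) ≡ bernoulli N +ℚ δ₁ N
sum-C*bernoulli-reversed N = begin
    sumℚ< (suc N) (λ t → ℕ→ℚ (N C t) *ℚ bernoulli (N ∸ t))
  ≡⟨ sumℚ<-reverse (suc N) _ ⟩
    sumℚ< (suc N) (λ i → ℕ→ℚ (N C (N ∸ i)) *ℚ bernoulli (N ∸ (N ∸ i)))
  ≡⟨ sumℚ<-cong< (suc N) (λ i i<1+N → cong₂ (λ c b → ℕ→ℚ c *ℚ bernoulli b)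
       (sym (nCk≡nC[n∸k] (ℕₚ.≤-pred i<1+N))) (ℕₚ.m∸[m∸n]≡n (ℕₚ.≤-pred i<1+N))) ⟩
    sumℚ< N (λ i → ℕ→ℚ (N C i) *ℚ bernoulli i) +ℚ ℕ→ℚ (N C N) *ℚ bernoulli N
  ≡⟨ cong₂ (λ a c → a +ℚ ℕ→ℚ c *ℚ bernoulli N) (sum-C*bernoulli N) (nCn≡1 N) ⟩
    δ₁ N +ℚ 1ℚ *ℚ bernoulli N
  ≡⟨ solve 2 (λ d b → d :+ con 1ℚ :* b := b :+ d) refl (δ₁ N) (bernoulli N) ⟩
    bernoulli N +ℚ δ₁ N
  ∎
  where open ≡-Reasoning

-- Bernoulli polynomials

bernoulliCoeff : ℕ → ℕ → ℚ
bernoulliCoeff q e = ℕ→ℚ (q C e) *ℚ bernoulli (q ∸ e)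

bernoulliPoly : ℕ → ℚ → ℚ
bernoulliPoly q x = sumℚ< (suc q) (λ e → bernoulliCoeff q e *ℚ x ^ℚ e)

bernoulliPoly-0 : ∀ q → bernoulliPoly q 0ℚ ≡ bernoulli q
bernoulliPoly-0 q = begin
    bernoulliPoly q 0ℚ
  ≡⟨ sumℚ<-head q _ ⟩
    1ℚ *ℚ bernoulli q *ℚ 1ℚ +ℚ sumℚ< q (λ e → bernoulliCoeff q (suc e) *ℚ (0ℚ *ℚ 0ℚ ^ℚ e))
  ≡⟨ cong (1ℚ *ℚ bernoulli q *ℚ 1ℚ +ℚ_) (trans (sumℚ<-cong q vanish) (sumℚ<-0 q)) ⟩
    1ℚ *ℚ bernoulli q *ℚ 1ℚ +ℚ 0ℚ
  ≡⟨ solve 1 (λ b → con 1ℚ :* b :* con 1ℚ :+ con 0ℚ := b) refl (bernoulli q) ⟩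
    bernoulli q
  ∎
  where
  open ≡-Reasoning
  vanish : ∀ e → bernoulliCoeff q (suc e) *ℚ (0ℚ *ℚ 0ℚ ^ℚ e) ≡ 0ℚ
  vanish e = trans (cong (bernoulliCoeff q (suc e) *ℚ_) (ℚₚ.*-zeroˡ (0ℚ ^ℚ e))) (ℚₚ.*-zeroʳ (bernoulliCoeff q (suc e)))

binomial-bernoulli-convolution : ∀ {q l} → l ≤ q → ∀ x →
  sumℚ< (suc q ∸ l) (λ t → bernoulliCoeff q (l + t) *ℚ (ℕ→ℚ ((l + t) C l) *ℚ x ^ℚ l))
    ≡ (ℕ→ℚ (q C l) *ℚ x ^ℚ l) *ℚ (bernoulli (q ∸ l) +ℚ δ₁ (q ∸ l))
binomial-bernoulli-convolution {q} {l} l≤q x = begin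
    sumℚ< (suc q ∸ l) (λ t → bernoulliCoeff q (l + t) *ℚ (ℕ→ℚ ((l + t) C l) *ℚ x ^ℚ l))
  ≡⟨ cong (λ s → sumℚ< s (λ t → bernoulliCoeff q (l + t) *ℚ (ℕ→ℚ ((l + t) C l) *ℚ x ^ℚ l))) (ℕₚ.+-∸-assoc 1 l≤q) ⟩
    sumℚ< (suc (q ∸ l)) (λ t → bernoulliCoeff q (l + t) *ℚ (ℕ→ℚ ((l + t) C l) *ℚ x ^ℚ l))
  ≡⟨ sumℚ<-cong< (suc (q ∸ l)) factor ⟩
    sumℚ< (suc (q ∸ l)) (λ t → c *ℚ (ℕ→ℚ ((q ∸ l) C t) *ℚ bernoulli (q ∸ l ∸ t)))
  ≡⟨ *-distribˡ-sumℚ< (suc (q ∸ l)) c _ ⟨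
    c *ℚ sumℚ< (suc (q ∸ l)) (λ t → ℕ→ℚ ((q ∸ l) C t) *ℚ bernoulli (q ∸ l ∸ t))
  ≡⟨ cong (c *ℚ_) (sum-C*bernoulli-reversed (q ∸ l)) ⟩
    c *ℚ (bernoulli (q ∸ l) +ℚ δ₁ (q ∸ l))
  ∎
  where
  open ≡-Reasoning
  c = ℕ→ℚ (q C l) *ℚ x ^ℚ l
  factor : ∀ t → t < suc (q ∸ l) → bernoulliCoeff q (l + t) *ℚ (ℕ→ℚ ((l + t) C l) *ℚ x ^ℚ l)
                                 ≡ c *ℚ (ℕ→ℚ ((q ∸ l) C t) *ℚ bernoulli (q ∸ l ∸ t))
  factor t t<1+q∸l = begin
      ℕ→ℚ (q C (l + t)) *ℚ bernoulli (q ∸ (l + t)) *ℚ (ℕ→ℚ ((l + t) C l) *ℚ x ^ℚ l)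
    ≡⟨ solve 4 (λ a b c' p → a :* b :* (c' :* p) := (a :* c') :* (p :* b)) refl
         (ℕ→ℚ (q C (l + t))) (bernoulli (q ∸ (l + t))) (ℕ→ℚ ((l + t) C l)) (x ^ℚ l) ⟩
      (ℕ→ℚ (q C (l + t)) *ℚ ℕ→ℚ ((l + t) C l)) *ℚ (x ^ℚ l *ℚ bernoulli (q ∸ (l + t)))
    ≡⟨ cong₂ (λ a b → a *ℚ (x ^ℚ l *ℚ bernoulli b)) binomials (sym (ℕₚ.∸-+-assoc q l t)) ⟩
      (ℕ→ℚ (q C l) *ℚ ℕ→ℚ ((q ∸ l) C t)) *ℚ (x ^ℚ l *ℚ bernoulli (q ∸ l ∸ t))
    ≡⟨ solve 4 (λ a b c' p → (a :* c') :* (p :* b) := (a :* p) :* (c' :* b)) refl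
         (ℕ→ℚ (q C l)) (bernoulli (q ∸ l ∸ t)) (ℕ→ℚ ((q ∸ l) C t)) (x ^ℚ l) ⟩
      c *ℚ (ℕ→ℚ ((q ∸ l) C t) *ℚ bernoulli (q ∸ l ∸ t))
    ∎
    where
    l+t≤q : l + t ≤ q
    l+t≤q = ℕₚ.≤-trans (ℕₚ.+-monoʳ-≤ l (ℕₚ.≤-pred t<1+q∸l)) (ℕₚ.≤-reflexive (ℕₚ.m+[n∸m]≡n l≤q))
    binomials : ℕ→ℚ (q C (l + t)) *ℚ ℕ→ℚ ((l + t) C l) ≡ ℕ→ℚ (q C l) *ℚ ℕ→ℚ ((q ∸ l) C t)
    binomials = trans (sym (ℕ→ℚ-* (q C (l + t)) ((l + t) C l)))
      (trans (cong ℕ→ℚ (nC[l+t]*[l+t]Cl≡nCl*[n∸l]Ct q l t l+t≤q)) (ℕ→ℚ-* (q C l) ((q ∸ l) C t)))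

bernoulliPoly-+1 : ∀ q x → bernoulliPoly q (x +ℚ 1ℚ)
  ≡ sumℚ< (suc q) (λ l → (ℕ→ℚ (q C l) *ℚ x ^ℚ l) *ℚ (bernoulli (q ∸ l) +ℚ δ₁ (q ∸ l)))
bernoulliPoly-+1 q x = begin
    sumℚ< (suc q) (λ e → bernoulliCoeff q e *ℚ (x +ℚ 1ℚ) ^ℚ e)
  ≡⟨ sumℚ<-cong (suc q) (λ e → trans (cong (bernoulliCoeff q e *ℚ_) (binomial-+1 e x))
       (*-distribˡ-sumℚ< (suc e) (bernoulliCoeff q e) _)) ⟩
    sumℚ< (suc q) (λ e → sumℚ< (suc e) (λ l → bernoulliCoeff q e *ℚ (ℕ→ℚ (e C l) *ℚ x ^ℚ l)))
  ≡⟨ sumℚ<-triangle (suc q) (λ e l → bernoulliCoeff q e *ℚ (ℕ→ℚ (e C l) *ℚ x ^ℚ l)) ⟩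
    sumℚ< (suc q) (λ l → sumℚ< (suc q ∸ l) (λ t → bernoulliCoeff q (l + t) *ℚ (ℕ→ℚ ((l + t) C l) *ℚ x ^ℚ l)))
  ≡⟨ sumℚ<-cong< (suc q) (λ l l<1+q → binomial-bernoulli-convolution (ℕₚ.≤-pred l<1+q) x) ⟩
    sumℚ< (suc q) (λ l → (ℕ→ℚ (q C l) *ℚ x ^ℚ l) *ℚ (bernoulli (q ∸ l) +ℚ δ₁ (q ∸ l)))
  ∎
  where open ≡-Reasoning

sum-C*^*δ₁ : ∀ p x →
  sumℚ< (suc (suc p)) (λ l → ℕ→ℚ (suc p C l) *ℚ x ^ℚ l *ℚ δ₁ (suc p ∸ l)) ≡ ℕ→ℚ (suc p) *ℚ x ^ℚ p
sum-C*^*δ₁ p x = begin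
    (sumℚ< p g +ℚ g p) +ℚ g (suc p)
  ≡⟨ cong₂ (λ a b → (a +ℚ g p) +ℚ b) (trans (sumℚ<-cong< p below) (sumℚ<-0 p)) top ⟩
    (0ℚ +ℚ g p) +ℚ 0ℚ
  ≡⟨ cong₂ (λ c d → (0ℚ +ℚ ℕ→ℚ c *ℚ x ^ℚ p *ℚ δ₁ d) +ℚ 0ℚ) [1+p]Cp≡1+p (ℕₚ.m+n∸n≡m 1 p) ⟩
    (0ℚ +ℚ ℕ→ℚ (suc p) *ℚ x ^ℚ p *ℚ 1ℚ) +ℚ 0ℚ
  ≡⟨ solve 2 (λ a b → (con 0ℚ :+ a :* b :* con 1ℚ) :+ con 0ℚ := a :* b) refl (ℕ→ℚ (suc p)) (x ^ℚ p) ⟩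
    ℕ→ℚ (suc p) *ℚ x ^ℚ p
  ∎
  where
  open ≡-Reasoning
  g = λ l → ℕ→ℚ (suc p C l) *ℚ x ^ℚ l *ℚ δ₁ (suc p ∸ l)
  below : ∀ l → l < p → g l ≡ 0ℚ
  below l l<p = trans (cong (λ d → ℕ→ℚ (suc p C l) *ℚ x ^ℚ l *ℚ δ₁ d) 1+p∸l≥2)
    (ℚₚ.*-zeroʳ (ℕ→ℚ (suc p C l) *ℚ x ^ℚ l))
    where
    1+p∸l≥2 : suc p ∸ l ≡ suc (suc (p ∸ suc l))
    1+p∸l≥2 = trans (ℕₚ.+-∸-assoc 1 (ℕₚ.<⇒≤ l<p)) (cong suc (ℕₚ.+-∸-assoc 1 l<p))
  top : g (suc p) ≡ 0ℚ
  top = trans (cong (λ d → ℕ→ℚ (suc p C suc p) *ℚ x ^ℚ suc p *ℚ δ₁ d) (ℕₚ.n∸n≡0 p))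
    (ℚₚ.*-zeroʳ (ℕ→ℚ (suc p C suc p) *ℚ x ^ℚ suc p))
  [1+p]Cp≡1+p : suc p C p ≡ suc p
  [1+p]Cp≡1+p = trans (nCk≡nC[n∸k] (ℕₚ.n≤1+n p)) (trans (cong (suc p C_) (ℕₚ.m+n∸n≡m 1 p)) (nC1≡n _))

bernoulliPoly-difference : ∀ p x →
  bernoulliPoly (suc p) (x +ℚ 1ℚ) ≡ bernoulliPoly (suc p) x +ℚ ℕ→ℚ (suc p) *ℚ x ^ℚ p
bernoulliPoly-difference p x = begin
    bernoulliPoly q (x +ℚ 1ℚ)
  ≡⟨ bernoulliPoly-+1 q x ⟩
    sumℚ< (suc q) (λ l → (ℕ→ℚ (q C l) *ℚ x ^ℚ l) *ℚ (bernoulli (q ∸ l) +ℚ δ₁ (q ∸ l)))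
  ≡⟨ sumℚ<-cong (suc q) (λ l → solve 4 (λ a p b d → (a :* p) :* (b :+ d) := a :* b :* p :+ a :* p :* d) refl
       (ℕ→ℚ (q C l)) (x ^ℚ l) (bernoulli (q ∸ l)) (δ₁ (q ∸ l))) ⟩
    sumℚ< (suc q) (λ l → bernoulliCoeff q l *ℚ x ^ℚ l +ℚ ℕ→ℚ (q C l) *ℚ x ^ℚ l *ℚ δ₁ (q ∸ l))
  ≡⟨ sumℚ<-+ (suc q) _ _ ⟩
    bernoulliPoly q x +ℚ sumℚ< (suc q) (λ l → ℕ→ℚ (q C l) *ℚ x ^ℚ l *ℚ δ₁ (q ∸ l))
  ≡⟨ cong (bernoulliPoly q x +ℚ_) (sum-C*^*δ₁ p x) ⟩
    bernoulliPoly q x +ℚ ℕ→ℚ q *ℚ x ^ℚ p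
  ∎
  where
  open ≡-Reasoning
  q = suc p

bernoulliPoly-ℕ : ∀ p n →
  bernoulliPoly (suc p) (ℕ→ℚ n) ≡ bernoulli (suc p) +ℚ ℕ→ℚ (suc p) *ℚ sumℚ< n (λ k → ℕ→ℚ k ^ℚ p)
bernoulliPoly-ℕ p zero = trans (bernoulliPoly-0 (suc p))
  (solve 2 (λ b q → b := b :+ q :* con 0ℚ) refl (bernoulli (suc p)) (ℕ→ℚ (suc p)))
bernoulliPoly-ℕ p (suc n) = begin
    bernoulliPoly (suc p) (ℕ→ℚ (suc n))
  ≡⟨ cong (bernoulliPoly (suc p)) (ℕ→ℚ-suc n) ⟩
    bernoulliPoly (suc p) (X +ℚ 1ℚ)
  ≡⟨ bernoulliPoly-difference p X ⟩
    bernoulliPoly (suc p) X +ℚ ℕ→ℚ (suc p) *ℚ X ^ℚ p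
  ≡⟨ cong (_+ℚ ℕ→ℚ (suc p) *ℚ X ^ℚ p) (bernoulliPoly-ℕ p n) ⟩
    bernoulli (suc p) +ℚ ℕ→ℚ (suc p) *ℚ A +ℚ ℕ→ℚ (suc p) *ℚ X ^ℚ p
  ≡⟨ solve 4 (λ b q s w → b :+ q :* s :+ q :* w := b :+ q :* (s :+ w)) refl
       (bernoulli (suc p)) (ℕ→ℚ (suc p)) A (X ^ℚ p) ⟩
    bernoulli (suc p) +ℚ ℕ→ℚ (suc p) *ℚ sumℚ< (suc n) (λ k → ℕ→ℚ k ^ℚ p)
  ∎
  where
  open ≡-Reasoning
  X = ℕ→ℚ n
  A = sumℚ< n (λ k → ℕ→ℚ k ^ℚ p)

bernoulliPoly-negℕ : ∀ p n →
  bernoulliPoly (suc p) (-ℚ ℕ→ℚ n) ≡ bernoulli (suc p) -ℚ ℕ→ℚ (suc p) *ℚ sumℚ< n (λ k → (-ℚ ℕ→ℚ (suc k)) ^ℚ p)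
bernoulliPoly-negℕ p zero = trans (bernoulliPoly-0 (suc p))
  (solve 2 (λ b q → b := b :- q :* con 0ℚ) refl (bernoulli (suc p)) (ℕ→ℚ (suc p)))
bernoulliPoly-negℕ p (suc n) = begin
    bernoulliPoly (suc p) x
  ≡⟨ solve 2 (λ u v → u := (u :+ v) :- v) refl (bernoulliPoly (suc p) x) (ℕ→ℚ (suc p) *ℚ x ^ℚ p) ⟩
    (bernoulliPoly (suc p) x +ℚ ℕ→ℚ (suc p) *ℚ x ^ℚ p) -ℚ ℕ→ℚ (suc p) *ℚ x ^ℚ p
  ≡⟨ cong (_-ℚ ℕ→ℚ (suc p) *ℚ x ^ℚ p) (bernoulliPoly-difference p x) ⟨
    bernoulliPoly (suc p) (x +ℚ 1ℚ) -ℚ ℕ→ℚ (suc p) *ℚ x ^ℚ p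
  ≡⟨ cong (λ y → bernoulliPoly (suc p) y -ℚ ℕ→ℚ (suc p) *ℚ x ^ℚ p) x+1≡-n ⟩
    bernoulliPoly (suc p) (-ℚ ℕ→ℚ n) -ℚ ℕ→ℚ (suc p) *ℚ x ^ℚ p
  ≡⟨ cong (_-ℚ ℕ→ℚ (suc p) *ℚ x ^ℚ p) (bernoulliPoly-negℕ p n) ⟩
    bernoulli (suc p) -ℚ ℕ→ℚ (suc p) *ℚ A -ℚ ℕ→ℚ (suc p) *ℚ x ^ℚ p
  ≡⟨ solve 4 (λ b q s w → b :- q :* s :- q :* w := b :- q :* (s :+ w)) refl
       (bernoulli (suc p)) (ℕ→ℚ (suc p)) A (x ^ℚ p) ⟩
    bernoulli (suc p) -ℚ ℕ→ℚ (suc p) *ℚ sumℚ< (suc n) (λ k → (-ℚ ℕ→ℚ (suc k)) ^ℚ p)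
  ∎
  where
  open ≡-Reasoning
  x = -ℚ ℕ→ℚ (suc n)
  A = sumℚ< n (λ k → (-ℚ ℕ→ℚ (suc k)) ^ℚ p)
  x+1≡-n : x +ℚ 1ℚ ≡ -ℚ ℕ→ℚ n
  x+1≡-n = trans (cong (λ y → -ℚ y +ℚ 1ℚ) (ℕ→ℚ-suc n))
    (solve 1 (λ a → :- (a :+ con 1ℚ) :+ con 1ℚ := :- a) refl (ℕ→ℚ n))

bernoulliPoly-−-odd : ∀ m x → let q = suc (m + m) in
  bernoulliPoly q x -ℚ bernoulliPoly q (-ℚ x)
    ≡ sumℚ< (suc m) (λ j → bernoulliCoeff q (suc (j + j)) *ℚ x ^ℚ suc (j + j)
                        +ℚ bernoulliCoeff q (suc (j + j)) *ℚ x ^ℚ suc (j + j))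
bernoulliPoly-−-odd m x = begin
    bernoulliPoly q x -ℚ bernoulliPoly q (-ℚ x)
  ≡⟨ sumℚ<-- (suc q) _ _ ⟨
    sumℚ< (suc q) h
  ≡⟨ cong (λ s → sumℚ< (suc s) h) (ℕₚ.+-suc m m) ⟨
    sumℚ< (suc m + suc m) h
  ≡⟨ sumℚ<-even-odd (suc m) h ⟩
    sumℚ< (suc m) (λ j → h (j + j) +ℚ h (suc (j + j)))
  ≡⟨ sumℚ<-cong (suc m) pair ⟩
    sumℚ< (suc m) (λ j → bernoulliCoeff q (suc (j + j)) *ℚ x ^ℚ suc (j + j)
                      +ℚ bernoulliCoeff q (suc (j + j)) *ℚ x ^ℚ suc (j + j))
  ∎
  where
  open ≡-Reasoning
  q = suc (m + m)
  h = λ e → bernoulliCoeff q e *ℚ x ^ℚ e -ℚ bernoulliCoeff q e *ℚ (-ℚ x) ^ℚ e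
  pair : ∀ j → h (j + j) +ℚ h (suc (j + j))
             ≡ bernoulliCoeff q (suc (j + j)) *ℚ x ^ℚ suc (j + j) +ℚ bernoulliCoeff q (suc (j + j)) *ℚ x ^ℚ suc (j + j)
  pair j = trans
    (cong₂ (λ u v → (c₀ *ℚ x ^ℚ (j + j) -ℚ c₀ *ℚ u) +ℚ (c₁ *ℚ x ^ℚ suc (j + j) -ℚ c₁ *ℚ v))
      (neg-^-even x j) (neg-^-odd x j))
    (solve 4 (λ c a d b → (c :* a :- c :* a) :+ (d :* b :- d :* (:- b)) := d :* b :+ d :* b) refl
      c₀ (x ^ℚ (j + j)) c₁ (x ^ℚ suc (j + j)))
    where
    c₀ = bernoulliCoeff q (j + j)
    c₁ = bernoulliCoeff q (suc (j + j))

bernoulliPoly-+-even : ∀ {q} m x → m + m ≡ q →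
  bernoulliPoly q x +ℚ bernoulliPoly q (-ℚ x)
    ≡ sumℚ< (suc m) (λ j → bernoulliCoeff q (j + j) *ℚ x ^ℚ (j + j) +ℚ bernoulliCoeff q (j + j) *ℚ x ^ℚ (j + j))
bernoulliPoly-+-even {q} m x refl = begin
    bernoulliPoly q x +ℚ bernoulliPoly q (-ℚ x)
  ≡⟨ sumℚ<-+ (suc q) _ _ ⟨
    sumℚ< q h +ℚ h q
  ≡⟨ cong₂ _+ℚ_ (trans (sumℚ<-even-odd m h) (sumℚ<-cong m pair)) (even m) ⟩
    sumℚ< (suc m) (λ j → e j +ℚ e j)
  ∎
  where
  open ≡-Reasoning
  h = λ i → bernoulliCoeff q i *ℚ x ^ℚ i +ℚ bernoulliCoeff q i *ℚ (-ℚ x) ^ℚ i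
  e = λ j → bernoulliCoeff q (j + j) *ℚ x ^ℚ (j + j)
  even : ∀ j → h (j + j) ≡ e j +ℚ e j
  even j = cong (λ y → e j +ℚ bernoulliCoeff q (j + j) *ℚ y) (neg-^-even x j)
  pair : ∀ j → h (j + j) +ℚ h (suc (j + j)) ≡ e j +ℚ e j
  pair j = trans
    (cong₂ (λ u v → u +ℚ (c₁ *ℚ x ^ℚ suc (j + j) +ℚ c₁ *ℚ v)) (even j) (neg-^-odd x j))
    (solve 3 (λ a c b → a :+ (c :* b :+ c :* (:- b)) := a) refl (e j +ℚ e j) c₁ (x ^ℚ suc (j + j)))
    where
    c₁ = bernoulliCoeff q (suc (j + j))

-- The identities for r = 0

powerSum : ℕ → ℕ → ℚ
powerSum p n = sumℚ< n (λ k → ℕ→ℚ (suc k) ^ℚ p)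

sum-^-from-0 : ∀ p n → sumℚ< n (λ k → ℕ→ℚ k ^ℚ suc p) ≡ powerSum (suc p) n -ℚ ℕ→ℚ n ^ℚ suc p
sum-^-from-0 p n = begin
    sumℚ< n (λ k → ℕ→ℚ k ^ℚ suc p)
  ≡⟨ solve 2 (λ a b → a := (a :+ b) :- b) refl _ (ℕ→ℚ n ^ℚ suc p) ⟩
    (sumℚ< n (λ k → ℕ→ℚ k ^ℚ suc p) +ℚ ℕ→ℚ n ^ℚ suc p) -ℚ ℕ→ℚ n ^ℚ suc p
  ≡⟨ cong (_-ℚ ℕ→ℚ n ^ℚ suc p) (sumℚ<-head n (λ k → ℕ→ℚ k ^ℚ suc p)) ⟩
    (0ℚ *ℚ 0ℚ ^ℚ p +ℚ powerSum (suc p) n) -ℚ ℕ→ℚ n ^ℚ suc p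
  ≡⟨ cong (λ z → (z +ℚ powerSum (suc p) n) -ℚ ℕ→ℚ n ^ℚ suc p) (ℚₚ.*-zeroˡ (0ℚ ^ℚ p)) ⟩
    (0ℚ +ℚ powerSum (suc p) n) -ℚ ℕ→ℚ n ^ℚ suc p
  ≡⟨ cong (_-ℚ ℕ→ℚ n ^ℚ suc p) (ℚₚ.+-identityˡ (powerSum (suc p) n)) ⟩
    powerSum (suc p) n -ℚ ℕ→ℚ n ^ℚ suc p
  ∎
  where open ≡-Reasoning

halve : ∀ a c R P → a +ℚ a ≡ c *ℚ (R +ℚ R -ℚ P) → a ≡ c *ℚ (R -ℚ ½ *ℚ P)
halve a c R P a+a≡ = begin
    a                            ≡⟨ solve 1 (λ a → a := con ½ :* (a :+ a)) refl a ⟩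
    ½ *ℚ (a +ℚ a)                ≡⟨ cong (½ *ℚ_) a+a≡ ⟩
    ½ *ℚ (c *ℚ (R +ℚ R -ℚ P))    ≡⟨ solve 3 (λ c R P → con ½ :* (c :* (R :+ R :- P)) := c :* (R :- con ½ :* P)) refl c R P ⟩
    c *ℚ (R -ℚ ½ *ℚ P)           ∎
  where open ≡-Reasoning

odd-part-at-ℕ : ∀ m' n → let m = suc m' ; p = m + m ; q = suc p ; X = ℕ→ℚ n in
  sumℚ< (suc m) (λ j → bernoulliCoeff q (suc (j + j)) *ℚ X ^ℚ suc (j + j))
    ≡ ℕ→ℚ q *ℚ (powerSum p n -ℚ ½ *ℚ X ^ℚ p)
odd-part-at-ℕ m' n = halve Σo (ℕ→ℚ q) R (X ^ℚ p) (begin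
    Σo +ℚ Σo
  ≡⟨ sumℚ<-+ (suc m) o o ⟨
    sumℚ< (suc m) (λ j → o j +ℚ o j)
  ≡⟨ bernoulliPoly-−-odd m X ⟨
    bernoulliPoly q X -ℚ bernoulliPoly q (-ℚ X)
  ≡⟨ cong₂ _-ℚ_ (bernoulliPoly-ℕ p n) (bernoulliPoly-negℕ p n) ⟩
    (b +ℚ ℕ→ℚ q *ℚ A) -ℚ (b -ℚ ℕ→ℚ q *ℚ A⁻)
  ≡⟨ cong₂ (λ a a⁻ → (b +ℚ ℕ→ℚ q *ℚ a) -ℚ (b -ℚ ℕ→ℚ q *ℚ a⁻))
       (sum-^-from-0 (m' + m) n) (sumℚ<-cong n (λ k → neg-^-even (ℕ→ℚ (suc k)) m)) ⟩
    (b +ℚ ℕ→ℚ q *ℚ (R -ℚ X ^ℚ p)) -ℚ (b -ℚ ℕ→ℚ q *ℚ R)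
  ≡⟨ solve 4 (λ b q R P → (b :+ q :* (R :- P)) :- (b :- q :* R) := q :* (R :+ R :- P)) refl
       b (ℕ→ℚ q) R (X ^ℚ p) ⟩
    ℕ→ℚ q *ℚ (R +ℚ R -ℚ X ^ℚ p)
  ∎)
  where
  open ≡-Reasoning
  m = suc m'
  p = m + m
  q = suc p
  X = ℕ→ℚ n
  b = bernoulli q
  o = λ j → bernoulliCoeff q (suc (j + j)) *ℚ X ^ℚ suc (j + j)
  Σo = sumℚ< (suc m) o
  R = powerSum p n
  A = sumℚ< n (λ k → ℕ→ℚ k ^ℚ p)
  A⁻ = sumℚ< n (λ k → (-ℚ ℕ→ℚ (suc k)) ^ℚ p)

-- The j = 0 term of the even part, B_q, is not in the sum.
even-part-at-ℕ : ∀ m' n → let m = suc m' ; p = suc (m' + m') ; q = suc p ; X = ℕ→ℚ n in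
  sumℚ< m (λ j → bernoulliCoeff q (suc j + suc j) *ℚ X ^ℚ (suc j + suc j))
    ≡ ℕ→ℚ q *ℚ (powerSum p n -ℚ ½ *ℚ X ^ℚ p)
even-part-at-ℕ m' n = halve Σe (ℕ→ℚ q) R (X ^ℚ p) (begin
    Σe +ℚ Σe
  ≡⟨ solve 2 (λ a s → s :+ s := ((a :+ s) :+ (a :+ s)) :- (a :+ a)) refl (e 0) Σe ⟩
    ((e 0 +ℚ Σe) +ℚ (e 0 +ℚ Σe)) -ℚ (e 0 +ℚ e 0)
  ≡⟨ cong (λ T → (T +ℚ T) -ℚ (e 0 +ℚ e 0)) (sumℚ<-head m e) ⟨
    (sumℚ< (suc m) e +ℚ sumℚ< (suc m) e) -ℚ (e 0 +ℚ e 0)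
  ≡⟨ cong (λ a → (sumℚ< (suc m) e +ℚ sumℚ< (suc m) e) -ℚ (a +ℚ a)) e0≡b ⟩
    (sumℚ< (suc m) e +ℚ sumℚ< (suc m) e) -ℚ (b +ℚ b)
  ≡⟨ cong (_-ℚ (b +ℚ b)) (trans (sym (sumℚ<-+ (suc m) e e)) (sym (bernoulliPoly-+-even m X 2m≡q))) ⟩
    (bernoulliPoly q X +ℚ bernoulliPoly q (-ℚ X)) -ℚ (b +ℚ b)
  ≡⟨ cong₂ (λ u v → (u +ℚ v) -ℚ (b +ℚ b)) (bernoulliPoly-ℕ p n) (bernoulliPoly-negℕ p n) ⟩
    ((b +ℚ ℕ→ℚ q *ℚ A) +ℚ (b -ℚ ℕ→ℚ q *ℚ A⁻)) -ℚ (b +ℚ b)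
  ≡⟨ cong₂ (λ a a⁻ → ((b +ℚ ℕ→ℚ q *ℚ a) +ℚ (b -ℚ ℕ→ℚ q *ℚ a⁻)) -ℚ (b +ℚ b)) (sum-^-from-0 (m' + m') n) negated ⟩
    ((b +ℚ ℕ→ℚ q *ℚ (R -ℚ X ^ℚ p)) +ℚ (b -ℚ ℕ→ℚ q *ℚ (-ℚ R))) -ℚ (b +ℚ b)
  ≡⟨ solve 4 (λ b q R P → ((b :+ q :* (R :- P)) :+ (b :- q :* (:- R))) :- (b :+ b) := q :* (R :+ R :- P)) refl
       b (ℕ→ℚ q) R (X ^ℚ p) ⟩
    ℕ→ℚ q *ℚ (R +ℚ R -ℚ X ^ℚ p)
  ∎)
  where
  open ≡-Reasoning
  m = suc m'
  p = suc (m' + m')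
  q = suc p
  X = ℕ→ℚ n
  b = bernoulli q
  e = λ j → bernoulliCoeff q (j + j) *ℚ X ^ℚ (j + j)
  Σe = sumℚ< m (λ j → e (suc j))
  R = powerSum p n
  A = sumℚ< n (λ k → ℕ→ℚ k ^ℚ p)
  A⁻ = sumℚ< n (λ k → (-ℚ ℕ→ℚ (suc k)) ^ℚ p)
  2m≡q : m + m ≡ q
  2m≡q = cong suc (ℕₚ.+-suc m' m')
  e0≡b : e 0 ≡ b
  e0≡b = solve 1 (λ b → con 1ℚ :* b :* con 1ℚ := b) refl b
  negated : A⁻ ≡ -ℚ R
  negated = trans (sumℚ<-cong n (λ k → neg-^-odd (ℕ→ℚ (suc k)) m')) (sym (neg-distrib-sumℚ< n _))

-- From r = 0 to all r

lift-to-powSum : ∀ (κ : ℚ) M (α : ℕ → ℚ) (ε : ℕ → ℕ) (β : ℕ → ℚ) d →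
  (∀ n → κ *ℚ sumℚ< M (λ j → α j *ℚ ℕ→ℚ (powSum 0 n (ε j)) *ℚ β j)
           ≡ ℕ→ℚ (powSum 1 n d) -ℚ ½ *ℚ ℕ→ℚ (powSum 0 n d)) →
  ∀ r n → κ *ℚ sumℚ< M (λ j → α j *ℚ ℕ→ℚ (powSum r n (ε j)) *ℚ β j)
           ≡ ℕ→ℚ (powSum (suc r) n d) -ℚ ½ *ℚ ℕ→ℚ (powSum r n d)
lift-to-powSum κ M α ε β d base zero    n = base n
lift-to-powSum κ M α ε β d base (suc r) n = begin
    κ *ℚ sumℚ< M (λ j → α j *ℚ ℕ→ℚ (sumℕ< n (λ i → powSum r (suc i) (ε j))) *ℚ β j)
  ≡⟨ cong (κ *ℚ_) (sumℚ<-cong M (λ j → trans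
       (cong (λ z → α j *ℚ z *ℚ β j) (ℕ→ℚ-sumℕ< n (λ i → powSum r (suc i) (ε j))))
       (trans (cong (_*ℚ β j) (*-distribˡ-sumℚ< n (α j) _)) (*-distribʳ-sumℚ< n (β j) _)))) ⟩
    κ *ℚ sumℚ< M (λ j → sumℚ< n (λ i → term i j))
  ≡⟨ cong (κ *ℚ_) (sumℚ<-swap M n term) ⟩
    κ *ℚ sumℚ< n (λ i → sumℚ< M (term i))
  ≡⟨ *-distribˡ-sumℚ< n κ _ ⟩
    sumℚ< n (λ i → κ *ℚ sumℚ< M (term i))
  ≡⟨ sumℚ<-cong n (λ i → lift-to-powSum κ M α ε β d base r (suc i)) ⟩
    sumℚ< n (λ i → ℕ→ℚ (powSum (suc r) (suc i) d) -ℚ ½ *ℚ ℕ→ℚ (powSum r (suc i) d))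
  ≡⟨ sumℚ<-- n _ _ ⟩
    sumℚ< n (λ i → ℕ→ℚ (powSum (suc r) (suc i) d)) -ℚ sumℚ< n (λ i → ½ *ℚ ℕ→ℚ (powSum r (suc i) d))
  ≡⟨ cong₂ (λ a b → a -ℚ b) (ℕ→ℚ-sumℕ< n _)
       (trans (cong (½ *ℚ_) (ℕ→ℚ-sumℕ< n _)) (*-distribˡ-sumℚ< n ½ _)) ⟨
    ℕ→ℚ (powSum (suc (suc r)) n d) -ℚ ½ *ℚ ℕ→ℚ (powSum (suc r) n d)
  ∎
  where
  open ≡-Reasoning
  term = λ i j → α j *ℚ ℕ→ℚ (powSum r (suc i) (ε j)) *ℚ β j

C*^*bernoulli≡bernoulliCoeff*^ : ∀ {q e} a b c n → a ≡ q → b ≡ e → c ≡ q ∸ e →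
  ℕ→ℚ (a C b) *ℚ ℕ→ℚ (n ^ b) *ℚ bernoulli c ≡ bernoulliCoeff q e *ℚ ℕ→ℚ n ^ℚ e
C*^*bernoulli≡bernoulliCoeff*^ {q} {e} _ _ _ n refl refl refl =
  trans (cong (λ z → ℕ→ℚ (q C e) *ℚ z *ℚ bernoulli (q ∸ e)) (ℕ→ℚ-^ n e))
    (solve 3 (λ c x b → c :* x :* b := c :* b :* x) refl (ℕ→ℚ (q C e)) (ℕ→ℚ n ^ℚ e) (bernoulli (q ∸ e)))

powSum-r≡0-in-ℚ : ∀ d p n → d ≡ p →
  ℕ→ℚ (powSum 1 n d) -ℚ ½ *ℚ ℕ→ℚ (powSum 0 n d) ≡ powerSum p n -ℚ ½ *ℚ ℕ→ℚ n ^ℚ p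
powSum-r≡0-in-ℚ d _ n refl = cong₂ (λ a b → a -ℚ ½ *ℚ b)
  (trans (ℕ→ℚ-sumℕ< n (λ i → suc i ^ d)) (sumℚ<-cong n (λ i → ℕ→ℚ-^ (suc i) d))) (ℕ→ℚ-^ n d)

even-exponent-identity₀ : ∀ m' n → let m = suc m' in
  (+ 1 / suc (2 * m)) *ℚ sumℚ< (suc m) (λ j → ℕ→ℚ (suc (2 * m) C (2 * suc j ∸ 1))
      *ℚ ℕ→ℚ (powSum 0 n (2 * suc j ∸ 1)) *ℚ bernoulli (2 * m + 2 ∸ 2 * suc j))
    ≡ ℕ→ℚ (powSum 1 n (2 * m)) -ℚ ½ *ℚ ℕ→ℚ (powSum 0 n (2 * m))
even-exponent-identity₀ m' n = begin
    (+ 1 / suc (2 * m)) *ℚ sumℚ< (suc m) _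
  ≡⟨ cong ((+ 1 / suc (2 * m)) *ℚ_) (sumℚ<-cong (suc m) (λ j →
       C*^*bernoulli≡bernoulliCoeff*^ _ _ _ n (cong suc 2m≡m+m) (exponent j) (index j))) ⟩
    (+ 1 / suc (2 * m)) *ℚ sumℚ< (suc m) (λ j → bernoulliCoeff (suc (m + m)) (suc (j + j)) *ℚ ℕ→ℚ n ^ℚ suc (j + j))
  ≡⟨ cong₂ (λ s t → (+ 1 / suc s) *ℚ t) 2m≡m+m (odd-part-at-ℕ m' n) ⟩
    (+ 1 / suc (m + m)) *ℚ (ℕ→ℚ (suc (m + m)) *ℚ (powerSum (m + m) n -ℚ ½ *ℚ ℕ→ℚ n ^ℚ (m + m)))
  ≡⟨ 1/[1+n]*[[1+n]*x]≡x (m + m) _ ⟩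
    powerSum (m + m) n -ℚ ½ *ℚ ℕ→ℚ n ^ℚ (m + m)
  ≡⟨ powSum-r≡0-in-ℚ (2 * m) (m + m) n 2m≡m+m ⟨
    ℕ→ℚ (powSum 1 n (2 * m)) -ℚ ½ *ℚ ℕ→ℚ (powSum 0 n (2 * m))
  ∎
  where
  open ≡-Reasoning
  m = suc m'
  2m≡m+m : 2 * m ≡ m + m
  2m≡m+m = cong (λ k → m + k) (ℕₚ.+-identityʳ m)
  exponent : ∀ j → 2 * suc j ∸ 1 ≡ suc (j + j)
  exponent j = trans (cong (λ k → j + k) (cong suc (ℕₚ.+-identityʳ j))) (ℕₚ.+-suc j j)
  index : ∀ j → 2 * m + 2 ∸ 2 * suc j ≡ suc (m + m) ∸ suc (j + j)
  index j = trans (cong (λ k → k ∸ 2 * suc j) (trans (ℕₚ.+-comm (2 * m) 2) (cong (λ s → suc (suc s)) 2m≡m+m)))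
    (cong (suc (m + m) ∸_) (exponent j))

odd-exponent-identity₀ : ∀ m' n → let m = suc m' in
  (+ 1 / (2 * m)) *ℚ sumℚ< m (λ j → ℕ→ℚ (2 * m C (2 * suc j))
      *ℚ ℕ→ℚ (powSum 0 n (2 * suc j)) *ℚ bernoulli (2 * m ∸ 2 * suc j))
    ≡ ℕ→ℚ (powSum 1 n (2 * m ∸ 1)) -ℚ ½ *ℚ ℕ→ℚ (powSum 0 n (2 * m ∸ 1))
odd-exponent-identity₀ m' n = begin
    (+ 1 / (2 * m)) *ℚ sumℚ< m _
  ≡⟨ cong₂ (λ s t → (+ 1 / suc s) *ℚ t) 2m∸1≡p (sumℚ<-cong m (λ j →
       C*^*bernoulli≡bernoulliCoeff*^ _ _ _ n 2m≡1+p (exponent j) (cong₂ _∸_ 2m≡1+p (exponent j)))) ⟩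
    (+ 1 / suc p) *ℚ sumℚ< m (λ j → bernoulliCoeff (suc p) (suc j + suc j) *ℚ ℕ→ℚ n ^ℚ (suc j + suc j))
  ≡⟨ cong ((+ 1 / suc p) *ℚ_) (even-part-at-ℕ m' n) ⟩
    (+ 1 / suc p) *ℚ (ℕ→ℚ (suc p) *ℚ (powerSum p n -ℚ ½ *ℚ ℕ→ℚ n ^ℚ p))
  ≡⟨ 1/[1+n]*[[1+n]*x]≡x p _ ⟩
    powerSum p n -ℚ ½ *ℚ ℕ→ℚ n ^ℚ p
  ≡⟨ powSum-r≡0-in-ℚ (2 * m ∸ 1) p n 2m∸1≡p ⟨
    ℕ→ℚ (powSum 1 n (2 * m ∸ 1)) -ℚ ½ *ℚ ℕ→ℚ (powSum 0 n (2 * m ∸ 1))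
  ∎
  where
  open ≡-Reasoning
  m = suc m'
  p = suc (m' + m')
  2m∸1≡p : 2 * m ∸ 1 ≡ p
  2m∸1≡p = trans (cong (λ k → m' + k) (cong suc (ℕₚ.+-identityʳ m'))) (ℕₚ.+-suc m' m')
  2m≡1+p : 2 * m ≡ suc p
  2m≡1+p = cong suc 2m∸1≡p
  exponent : ∀ j → 2 * suc j ≡ suc j + suc j
  exponent j = cong (λ k → suc j + k) (ℕₚ.+-identityʳ (suc j))

mainTheorem1 : (r m n : ℕ) → (m>0 : 0 < m) → 0 < n →
    (((+ 1 / suc (2 * m)) *ℚ
       sumℚ1to (suc m) (λ j → ℕ→ℚ (suc (2 * m) C (2 * j ∸ 1))
                               *ℚ ℕ→ℚ (powSum r n (2 * j ∸ 1))
                               *ℚ bernoulli (2 * m + 2 ∸ 2 * j)))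
      ≡ ℕ→ℚ (powSum (suc r) n (2 * m)) -ℚ ½ *ℚ ℕ→ℚ (powSum r n (2 * m)))
    ×
    (((+ 1 / (2 * m)) {{ m*n≢0 2 m {{ _ }} {{ >-nonZero m>0 }} }} *ℚ
       sumℚ1to m (λ j → ℕ→ℚ (2 * m C (2 * j))
                         *ℚ ℕ→ℚ (powSum r n (2 * j))
                         *ℚ bernoulli (2 * m ∸ 2 * j)))
      ≡ ℕ→ℚ (powSum (suc r) n (2 * m ∸ 1)) -ℚ ½ *ℚ ℕ→ℚ (powSum r n (2 * m ∸ 1)))
mainTheorem1 r m@(suc m') n _ _ =
  lift-to-powSum (+ 1 / suc (2 * m)) (suc m) (λ j → ℕ→ℚ (suc (2 * m) C (2 * suc j ∸ 1))) (λ j → 2 * suc j ∸ 1)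
    (λ j → bernoulli (2 * m + 2 ∸ 2 * suc j)) (2 * m) (even-exponent-identity₀ m') r n ,
  lift-to-powSum (+ 1 / (2 * m)) m (λ j → ℕ→ℚ (2 * m C (2 * suc j))) (λ j → 2 * suc j)
    (λ j → bernoulli (2 * m ∸ 2 * suc j)) (2 * m ∸ 1) (odd-exponent-identity₀ m') r n
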